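{- Let $\Delta_2>\Delta_1\ge1$ be integers and let $\mathcal G$ be any $(\Delta_1,\Delta_2)$-cluster temporal graph. Then any $\Delta_2$-indivisible set $S\subseteq\mathcal E(\mathcal G)$ is contained within a single $\Delta_1$-temporal clique of $\mathcal G$.
   Context: A temporal graph $\mathcal G=(G,\mathcal T)$ consists of a finite static undirected graph $G=(V,E)$ and a function $\mathcal T:E\to 2^{\mathbb Z^+}\setminus\{\emptyset\}$ (finite sets); its time-edges are $\mathcal E(\mathcal G)=\{(e,t):e\in E,\ t\in\mathcal T(e)\}$ and its lifetime is $T(\mathcal G)=\max\{t:(e,t)\in\mathcal E(\mathcal G)\}$. An interval $[a,b]$ means $\{a,\dots,b\}\subseteq\mathbb Z$. An edge $e$ is $\Delta_1$-dense in $[a,b]$ if for every $\tau\in[a,\max\{a,b-\Delta_1+1\}]$ there is $t\in\mathcal T(e)$ with $\tau\le t\le\tau+\Delta_1-1$. For a set $S$ of time-edges, $V(S)$ is the set of endpoints of its time-edges and $L(S)=[\min\{t:(e,t)\in S\},\max\{t:(e,t)\in S\}]$; $S$ generates the template $(V(S),L(S))$. A set $S$ of time-edges forms a $\Delta_1$-temporal clique if for every pair of distinct $x,y\in V(S)$ the edge $xy$ is $\Delta_1$-dense in $L(S)$. Templates $(X,[a,b])$, $(Y,[c,d])$ are $\Delta_2$-independent if $X\cap Y=\emptyset$ or $|s-t|\ge\Delta_2$ for all $s\in[a,b]$, $t\in[c,d]$; two sets of time-edges are $\Delta_2$-independent if the templates they generate are. A set of time-edges is $\Delta_2$-indivisible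 if it cannot be written as the union of at least two nonempty, pairwise $\Delta_2$-independent sets of time-edges. $\mathcal G$ realises a collection $\{(X_i,[a_i,b_i])\}_i$ of pairwise $\Delta_2$-independent templates with $1\le a_i\le b_i\le T(\mathcal G)$ if every time-edge $(xy,t)$ has some $i$ with $x,y\in X_i$, $t\in[a_i,b_i]$, and for every $i$ and distinct $x,y\in X_i$, $xy$ is an edge that is $\Delta_1$-dense in $[a_i,b_i]$; $\mathcal G$ is a $(\Delta_1,\Delta_2)$-cluster temporal graph if it realises some such collection, whose templates' time-edge sets are the $\Delta_1$-temporal cliques of $\mathcal G$ in its decomposition. -}

module Defs where

open import Level using (0ℓ)
open import Data.Nat using (ℕ; zero; suc; _+_; _∸_; _≤_; _<_; _⊔_; _⊓_; ∣_-_∣)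
open import Data.Fin using (Fin)
open import Data.List using (List; []; _∷_; foldr; map)
open import Data.List.Membership.Propositional using (_∈_)
open import Data.Product using (Σ; ∃; ∃-syntax; _×_; _,_; proj₁; proj₂)
open import Data.Sum using (_⊎_)
open import Relation.Nullary using (¬_)
open import Relation.Binary.PropositionalEquality using (_≡_; _≢_)
open import Function.Bundles using (_⇔_)

-- A time-edge (x , y , t) stands for the time-edge ({x,y}, t).
-- Orientation is irrelevant: membership is always tested up to swapping x,y.
TE : ℕ → Set
TE n = Fin n × Fin n × ℕ

time : ∀ {n} → TE n → ℕ
time (_ , _ , t) = t

_∈ᵤ_ : ∀ {n} → TE n → List (TE n) → Set
(x , y , t) ∈ᵤ L = ((x , y , t) ∈ L) ⊎ ((y , x , t) ∈ L)

-- The static edge set E is {xy : some (xy,t) ∈ E(G)},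
-- and T(xy) = {t : (xy,t) ∈ E(G)} (nonempty for every edge, finite).
record TemporalGraph : Set where
  field
    n         : ℕ
    timeEdges : List (TE n)
    loopless  : ∀ {x y t} → (x , y , t) ∈ timeEdges → x ≢ y
    positive  : ∀ {x y t} → (x , y , t) ∈ timeEdges → 1 ≤ t

open TemporalGraph public

HasTime : (G : TemporalGraph) → Fin (n G) → Fin (n G) → ℕ → Set
HasTime G x y t = (x , y , t) ∈ᵤ timeEdges G

IsEdge : (G : TemporalGraph) → Fin (n G) → Fin (n G) → Set
IsEdge G x y = ∃[ t ] HasTime G x y t

lo : ∀ {n} → List (TE n) → ℕ
lo []       = 0
lo (e ∷ es) = foldr _⊓_ (time e) (map time es)

hi : ∀ {n} → List (TE n) → ℕ
hi []       = 0
hi (e ∷ es) = foldr _⊔_ (time e) (map time es)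

lifetime : TemporalGraph → ℕ
lifetime G = hi (timeEdges G)

Dense : (G : TemporalGraph) → ℕ → Fin (n G) → Fin (n G) → ℕ → ℕ → Set
Dense G Δ₁ x y a b =
  ∀ τ → a ≤ τ → τ ≤ a ⊔ (b + 1 ∸ Δ₁) →
  ∃[ t ] (HasTime G x y t × τ ≤ t × t ≤ τ + Δ₁ ∸ 1)

record Template (n : ℕ) : Set₁ where
  constructor template
  field
    X : Fin n → Set
    a : ℕ
    b : ℕ

open Template public

Independent : ∀ {n} → ℕ → Template n → Template n → Set
Independent Δ₂ T₁ T₂ =
  (∀ v → ¬ (X T₁ v × X T₂ v)) ⊎
  (∀ s t → a T₁ ≤ s → s ≤ b T₁ → a T₂ ≤ t → t ≤ b T₂ → Δ₂ ≤ ∣ s - t ∣)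

Verts : ∀ {n} → List (TE n) → Fin n → Set
Verts S v = ∃[ x ] ∃[ y ] ∃[ t ] ((x , y , t) ∈ S × (v ≡ x ⊎ v ≡ y))

generated : ∀ {n} → List (TE n) → Template n
generated S = template (Verts S) (lo S) (hi S)

IndependentSets : ∀ {n} → ℕ → List (TE n) → List (TE n) → Set
IndependentSets Δ₂ S₁ S₂ = Independent Δ₂ (generated S₁) (generated S₂)

Nonempty : ∀ {A : Set} → List A → Set
Nonempty {A} L = ∃[ e ] (e ∈ L)

Indivisible : ∀ {n} → ℕ → List (TE n) → Set
Indivisible {n} Δ₂ S =
  ¬ (Σ ℕ λ k → 2 ≤ k × Σ (Fin k → List (TE n)) λ P →
       (∀ i → Nonempty (P i)) ×
       (∀ i j → i ≢ j → IndependentSets Δ₂ (P i) (P j)) ×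
       (∀ x y t → ((x , y , t) ∈ᵤ S) ⇔ (∃[ i ] ((x , y , t) ∈ᵤ P i))))

SubsetOfTimeEdges : (G : TemporalGraph) → List (TE (n G)) → Set
SubsetOfTimeEdges G S = ∀ {x y t} → (x , y , t) ∈ S → HasTime G x y t

Realises : (G : TemporalGraph) → ℕ → ℕ → (k : ℕ) → (Fin k → Template (n G)) → Set
Realises G Δ₁ Δ₂ k C =
  (∀ i j → i ≢ j → Independent Δ₂ (C i) (C j)) ×
  (∀ i → 1 ≤ a (C i) × a (C i) ≤ b (C i) × b (C i) ≤ lifetime G) ×
  (∀ x y t → HasTime G x y t →
     ∃[ i ] (X (C i) x × X (C i) y × a (C i) ≤ t × t ≤ b (C i))) ×
  (∀ i x y → X (C i) x → X (C i) y → x ≢ y →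
     IsEdge G x y × Dense G Δ₁ x y (a (C i)) (b (C i)))

IsCluster : TemporalGraph → ℕ → ℕ → Set₁
IsCluster G Δ₁ Δ₂ = Σ ℕ λ k → Σ (Fin k → Template (n G)) λ C → Realises G Δ₁ Δ₂ k C

-- (xy,t) lies in the time-edge set of template T of the decomposition
-- (the Δ₁-temporal clique associated with T)
InClique : (G : TemporalGraph) → Template (n G) → Fin (n G) → Fin (n G) → ℕ → Set
InClique G T x y t = HasTime G x y t × X T x × X T y × a T ≤ t × t ≤ b T

-- Place every time-edge of S in a template of the decomposition that contains
-- it, and group S by template.  Each group generates a template contained in
-- its own template of the decomposition, so distinct groups are Δ₂-independent
-- because the decomposition's templates are; indivisibility of S then leaves
-- room for a single group.
module Submission where

open import Defs
open import Data.Nat using (ℕ; _≤_; _<_; s≤s; z≤n)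
open import Data.Nat.Properties using (≤-trans; ⊓-glb; ⊔-lub)
open import Data.Fin using (Fin; zero; suc)
open import Data.Fin.Properties using (_≟_)
open import Data.List using (List; []; _∷_; map; filter; length; lookup; deduplicate)
open import Data.List.Properties using (foldr-preservesᵇ)
open import Data.List.Membership.Propositional using (_∈_; mapWith∈)
open import Data.List.Membership.Propositional.Properties
  using (∈-map⁺; ∈-map⁻; ∈-filter⁺; ∈-filter⁻; ∈-deduplicate⁺; ∈-deduplicate⁻; ∈-lookup)
import Data.List.Relation.Unary.All as All
open import Data.List.Relation.Unary.All.Properties using (map⁺)
open import Data.List.Relation.Unary.Any using (here; there; index)
open import Data.List.Relation.Unary.Any.Properties using (lookup-index; mapWith∈⁺; mapWith∈⁻)
open import Data.List.Relation.Unary.AllPairs using (_∷_)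
open import Data.List.Relation.Unary.Unique.Propositional using (Unique)
open import Data.List.Relation.Unary.Unique.DecPropositional.Properties using (deduplicate-!)
open import Data.Product using (∃-syntax; _×_; _,_; proj₁; proj₂)
open import Data.Sum using (inj₁; inj₂)
open import Data.Empty using (⊥-elim)
open import Function using (_∘_)
open import Function.Bundles using (_⇔_; mk⇔)
open import Relation.Binary.Definitions using (DecidableEquality)
open import Relation.Binary.PropositionalEquality using (_≡_; _≢_; refl; sym; subst; cong)
open import Relation.Nullary using (¬_; yes; no)

lookup-injective : ∀ {A : Set} {xs : List A} → Unique xs →
                   ∀ i j → lookup xs i ≡ lookup xs j → i ≡ j
lookup-injective (_ ∷ _)      zero    zero    _  = refl
lookup-injective (x∉xs ∷ _)   zero    (suc j) eq = ⊥-elim (All.lookup x∉xs (∈-lookup j) eq)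
lookup-injective (x∉xs ∷ _)   (suc i) zero    eq = ⊥-elim (All.lookup x∉xs (∈-lookup i) (sym eq))
lookup-injective (_ ∷ unique) (suc i) (suc j) eq = cong suc (lookup-injective unique i j eq)

distinct-members⇒2≤length : ∀ {A : Set} {x y : A} {xs : List A} →
                            x ∈ xs → y ∈ xs → x ≢ y → 2 ≤ length xs
distinct-members⇒2≤length {xs = _ ∷ _ ∷ _} _           _           _   = s≤s (s≤s z≤n)
distinct-members⇒2≤length {xs = _ ∷ []} (here refl) (here refl) x≢y = ⊥-elim (x≢y refl)

module GroupBy {A B : Set} (_≟ᴮ_ : DecidableEquality B) (key : A → B) (L : List A) where

  keys : List B
  keys = deduplicate _≟ᴮ_ (map key L)

  group : Fin (length keys) → List A
  group j = filter (λ r → key r ≟ᴮ lookup keys j) L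

  key∈keys : ∀ {r} → r ∈ L → key r ∈ keys
  key∈keys = ∈-deduplicate⁺ _≟ᴮ_ ∘ ∈-map⁺ key

  lookup-keys-injective : ∀ i j → lookup keys i ≡ lookup keys j → i ≡ j
  lookup-keys-injective = lookup-injective (deduplicate-! _≟ᴮ_ (map key L))

  group-nonempty : ∀ j → Nonempty (group j)
  group-nonempty j with ∈-map⁻ key (∈-deduplicate⁻ _≟ᴮ_ (map key L) (∈-lookup j))
  ... | r , r∈L , eq = r , ∈-filter⁺ (λ r → key r ≟ᴮ lookup keys j) r∈L (sym eq)

  ∈-group⁺ : ∀ {r} → r ∈ L → ∃[ j ] (r ∈ group j)
  ∈-group⁺ {r} r∈L = j , ∈-filter⁺ (λ r → key r ≟ᴮ lookup keys j) r∈L (lookup-index r∈keys)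
    where
    r∈keys : key r ∈ keys
    r∈keys = key∈keys r∈L
    j : Fin (length keys)
    j = index r∈keys

  ∈-group⁻ : ∀ {r} j → r ∈ group j → r ∈ L × key r ≡ lookup keys j
  ∈-group⁻ j = ∈-filter⁻ (λ r → key r ≟ᴮ lookup keys j)

_∈ₜ_ : ∀ {n} → TE n → Template n → Set
(x , y , t) ∈ₜ T = X T x × X T y × a T ≤ t × t ≤ b T

_⊑_ : ∀ {n} → Template n → Template n → Set
T ⊑ U = (∀ v → X T v → X U v) × a U ≤ a T × b T ≤ b U

independent-antimono : ∀ {n Δ₂} {T T′ U U′ : Template n} → T ⊑ T′ → U ⊑ U′ →
                       Independent Δ₂ T′ U′ → Independent Δ₂ T U
independent-antimono (XT⊆ , _ , _) (XU⊆ , _ , _) (inj₁ disjoint) =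
  inj₁ (λ v (v∈T , v∈U) → disjoint v (XT⊆ v v∈T , XU⊆ v v∈U))
independent-antimono (_ , aT′≤aT , bT≤bT′) (_ , aU′≤aU , bU≤bU′) (inj₂ apart) =
  inj₂ (λ s t aT≤s s≤bT aU≤t t≤bU →
    apart s t (≤-trans aT′≤aT aT≤s) (≤-trans s≤bT bT≤bT′) (≤-trans aU′≤aU aU≤t) (≤-trans t≤bU bU≤bU′))

lo-glb : ∀ {n m} {S : List (TE n)} → Nonempty S → (∀ {e} → e ∈ S → m ≤ time e) → m ≤ lo S
lo-glb {m = m} {S = _ ∷ _} _ m≤ =
  foldr-preservesᵇ {P = m ≤_} ⊓-glb (m≤ (here refl)) (map⁺ (All.tabulate (m≤ ∘ there)))

hi-lub : ∀ {n m} {S : List (TE n)} → (∀ {e} → e ∈ S → time e ≤ m) → hi S ≤ m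
hi-lub         {S = []}    _  = z≤n
hi-lub {m = m} {S = _ ∷ _} ≤m =
  foldr-preservesᵇ {P = _≤ m} ⊔-lub (≤m (here refl)) (map⁺ (All.tabulate (≤m ∘ there)))

generated-⊑ : ∀ {n} {T : Template n} {S : List (TE n)} → Nonempty S →
              (∀ {e} → e ∈ S → e ∈ₜ T) → generated S ⊑ T
generated-⊑ nonempty S⊆T =
  (λ { _ (_ , _ , _ , e∈S , inj₁ refl) → let x∈X , _ = S⊆T e∈S in x∈X
     ; _ (_ , _ , _ , e∈S , inj₂ refl) → let _ , y∈X , _ = S⊆T e∈S in y∈X }) ,
  lo-glb nonempty (λ {(_ , _ , _)} e∈S → let _ , _ , a≤t , _ = S⊆T e∈S in a≤t) ,
  hi-lub (λ {(_ , _ , _)} e∈S → let _ , _ , _ , t≤b = S⊆T e∈S in t≤b)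

∈ᵤ-⋃ : ∀ {n m} {S : List (TE n)} {P : Fin m → List (TE n)} →
       (∀ {e} → e ∈ S → ∃[ j ] (e ∈ P j)) → (∀ {e} j → e ∈ P j → e ∈ S) →
       ∀ x y t → ((x , y , t) ∈ᵤ S) ⇔ (∃[ j ] ((x , y , t) ∈ᵤ P j))
∈ᵤ-⋃ {S = S} {P} S⊆⋃P ⋃P⊆S x y t = mk⇔ to from
  where
  to : (x , y , t) ∈ᵤ S → ∃[ j ] ((x , y , t) ∈ᵤ P j)
  to (inj₁ xyt∈S) = let j , xyt∈P = S⊆⋃P xyt∈S in j , inj₁ xyt∈P
  to (inj₂ yxt∈S) = let j , yxt∈P = S⊆⋃P yxt∈S in j , inj₂ yxt∈P

  from : ∃[ j ] ((x , y , t) ∈ᵤ P j) → (x , y , t) ∈ᵤ S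
  from (j , inj₁ xyt∈P) = inj₁ (⋃P⊆S j xyt∈P)
  from (j , inj₂ yxt∈P) = inj₂ (⋃P⊆S j yxt∈P)

module Placement {n k} (Δ₂ : ℕ) (C : Fin k → Template n)
                 (independent : ∀ i j → i ≢ j → Independent Δ₂ (C i) (C j))
                 (S : List (TE n)) (place : ∀ {e} → e ∈ S → ∃[ i ] (e ∈ₜ C i)) where

  Placed : Set
  Placed = ∃[ e ] ∃[ i ] (e ∈ₜ C i)

  placements : List Placed
  placements = mapWith∈ S (λ {e} e∈S → e , place e∈S)

  placed : ∀ {e} (e∈S : e ∈ S) → (e , place e∈S) ∈ placements
  placed e∈S = mapWith∈⁺ _ (_ , e∈S , refl)

  open GroupBy _≟_ (proj₁ ∘ proj₂) placements

  part : Fin (length keys) → List (TE n)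
  part j = map proj₁ (group j)

  part-nonempty : ∀ j → Nonempty (part j)
  part-nonempty j = let r , r∈group = group-nonempty j in proj₁ r , ∈-map⁺ proj₁ r∈group

  part-within : ∀ j {e} → e ∈ part j → e ∈ₜ C (lookup keys j)
  part-within j e∈part with ∈-map⁻ proj₁ e∈part
  ... | (e , i , e∈C) , r∈group , refl = subst (λ i → e ∈ₜ C i) (proj₂ (∈-group⁻ j r∈group)) e∈C

  parts-independent : ∀ i j → i ≢ j → IndependentSets Δ₂ (part i) (part j)
  parts-independent i j i≢j =
    independent-antimono (generated-⊑ (part-nonempty i) (part-within i))
                         (generated-⊑ (part-nonempty j) (part-within j))
                         (independent _ _ (i≢j ∘ lookup-keys-injective i j))

  ∈-part⁺ : ∀ {e} → e ∈ S → ∃[ j ] (e ∈ part j)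
  ∈-part⁺ e∈S = let j , r∈group = ∈-group⁺ (placed e∈S) in j , ∈-map⁺ proj₁ r∈group

  ∈-part⁻ : ∀ {e} j → e ∈ part j → e ∈ S
  ∈-part⁻ j e∈part with ∈-map⁻ proj₁ e∈part
  ... | r , r∈group , refl with mapWith∈⁻ S _ (proj₁ (∈-group⁻ j r∈group))
  ... | _ , e∈S , refl = e∈S

  many-templates⇒divisible : 2 ≤ length keys → ¬ Indivisible Δ₂ S
  many-templates⇒divisible 2≤#keys indivisible =
    indivisible (length keys , 2≤#keys , part , part-nonempty , parts-independent , ∈ᵤ-⋃ ∈-part⁺ ∈-part⁻)

  indivisible⇒one-template : Indivisible Δ₂ S → ∀ {e e′} (e∈S : e ∈ S) (e′∈S : e′ ∈ S) →
                             proj₁ (place e∈S) ≡ proj₁ (place e′∈S)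
  indivisible⇒one-template indivisible e∈S e′∈S with proj₁ (place e∈S) ≟ proj₁ (place e′∈S)
  ... | yes same = same
  ... | no differ = ⊥-elim (many-templates⇒divisible
          (distinct-members⇒2≤length (key∈keys (placed e∈S)) (key∈keys (placed e′∈S)) differ) indivisible)

lemma5 : (Δ₁ Δ₂ : ℕ) → 1 ≤ Δ₁ → Δ₁ < Δ₂ →
         (G : TemporalGraph) → (k : ℕ) → (C : Fin k → Template (n G)) →
         Realises G Δ₁ Δ₂ k C →
         (S : List (TE (n G))) → SubsetOfTimeEdges G S → Nonempty S →
         Indivisible Δ₂ S →
         ∃[ i ] (∀ {x y t} → (x , y , t) ∈ S → InClique G (C i) x y t)
lemma5 _ Δ₂ _ _ G k C (independent , _ , cover , _) S S⊆G (_ , e₀∈S) indivisible =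
  proj₁ (place e₀∈S) , λ e∈S →
    S⊆G e∈S , subst (λ i → _ ∈ₜ C i) (indivisible⇒one-template indivisible e∈S e₀∈S) (proj₂ (place e∈S))
  where
  place : ∀ {e} → e ∈ S → ∃[ i ] (e ∈ₜ C i)
  place {x , y , t} e∈S = cover x y t (S⊆G e∈S)

  open Placement Δ₂ C independent S place using (indivisible⇒one-template)
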